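{- Let $H$ be a MAG of order $p$, let $\mathbf{u}_a,\mathbf{u}_b\in\mathbb{V}(H)$ be distinct composite vertices, let $P_s$ be a shortest path on $H$ from $\mathbf{u}_a$ to $\mathbf{u}_b$, and let $\zeta$ be a sub-determination of $H$. Then there is a weak shortest path $P\zeta_s$ from $S_\zeta(\mathbf{u}_a)$ to $S_\zeta(\mathbf{u}_b)$ with $Len(P\zeta_s)\le Len(P_s)$.
   Context: A MultiAspect Graph (MAG) of order $p\ge 1$ is a pair $H=(A,E)$, where $A=[A[1],\dots,A[p]]$ is a finite list of finite sets (aspects) and $E\subseteq A[1]\times\cdots\times A[p]\times A[1]\times\cdots\times A[p]$ is a set of $2p$-tuples called edges. Composite vertices are elements of $\mathbb{V}(H)=A[1]\times\cdots\times A[p]$. For $e=(a_1,\dots,a_p,b_1,\dots,b_p)$, $\pi_o(e)=(a_1,\dots,a_p)$, $\pi_d(e)=(b_1,\dots,b_p)$; edges satisfy $\pi_o(e)\neq\pi_d(e)$. A walk on $H$ from $\mathbf{u}_1$ to $\mathbf{u}_k$ is $[\mathbf{u}_1,e_1,\dots,e_{k-1},\mathbf{u}_k]$ with $e_n\in E(H)$, $\mathbf{u}_n=\pi_o(e_n)$, $\mathbf{u}_{n+1}=\pi_d(e_n)$; its length $Len$ is $k-1$. A path is a walk with pairwise distinct composite vertices; a shortest path from $\mathbf{u}$ to $\mathbf{v}$ is a path from $\mathbf{u}$ to $\mathbf{v}$ of minimal length among all such paths. A sub-determination $\zeta$ (for $p\ge 2$) is a choice of indices $1\le\zeta_1<\cdots<\zeta_m\le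 p$ with $1\le m<p$, defining $S_\zeta(a_1,\dots,a_p)=(a_{\zeta_1},\dots,a_{\zeta_m})$. A weak shortest path from $S_\zeta(\mathbf{u}_a)$ to $S_\zeta(\mathbf{u}_b)$ is a path on $H$ from some composite vertex $\mathbf{x}$ with $S_\zeta(\mathbf{x})=S_\zeta(\mathbf{u}_a)$ to some composite vertex $\mathbf{y}$ with $S_\zeta(\mathbf{y})=S_\zeta(\mathbf{u}_b)$, of minimal length among all such paths. -}

module Defs where

open import Data.Nat using (ℕ; zero; suc; _≤_; _<_)
open import Data.Fin using (Fin)
import Data.Fin as F
open import Data.Vec using (Vec; []; _∷_; lookup; map)
open import Data.List using (List; []; _∷_)
open import Data.List.Membership.Propositional using (_∈_)
open import Data.List.Relation.Unary.All using (All)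
open import Data.List.Relation.Unary.Unique.Propositional using (Unique)
open import Data.Vec.Relation.Unary.Linked using (Linked)
open import Data.Product using (Σ; _×_; _,_; proj₁; proj₂)
open import Relation.Binary.PropositionalEquality using (_≡_; _≢_)

-- Composite vertices: a dependent tuple whose i-th entry lies in the
-- i-th aspect, the aspect A[i] being modelled as Fin (ns[i]).
data Tuple : {p : ℕ} → Vec ℕ p → Set where
  []  : Tuple []
  _∷_ : {p : ℕ} {n : ℕ} {ns : Vec ℕ p} → Fin n → Tuple ns → Tuple (n ∷ ns)

lookupT : {p : ℕ} {ns : Vec ℕ p} → Tuple ns → (i : Fin p) → Fin (lookup ns i)
lookupT (a ∷ t) F.zero    = a
lookupT (a ∷ t) (F.suc i) = lookupT t i

record MAG : Set where
  field
    p     : ℕ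
    1≤p   : 1 ≤ p
    sizes : Vec ℕ p
  V : Set
  V = Tuple sizes
  field
    E     : List (V × V)
    loopless : All (λ e → proj₁ e ≢ proj₂ e) E

module _ (H : MAG) where
  open MAG H

  data Walk : V → V → Set where
    stop : (u : V) → Walk u u
    step : {u w v : V} → (u , w) ∈ E → Walk w v → Walk u v

  Len : {u v : V} → Walk u v → ℕ
  Len (stop _)   = zero
  Len (step _ w) = suc (Len w)

  vertices : {u v : V} → Walk u v → List V
  vertices (stop u)          = u ∷ []
  vertices (step {u} _ w)    = u ∷ vertices w

  IsPath : {u v : V} → Walk u v → Set
  IsPath w = Unique (vertices w)

  IsShortestPath : {u v : V} → Walk u v → Set
  IsShortestPath {u} {v} P =
    IsPath P × ((Q : Walk u v) → IsPath Q → Len P ≤ Len Q)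

  record SubDetermination : Set where
    field
      m     : ℕ
      1≤m   : 1 ≤ m
      m<p   : m < p
      idx   : Vec (Fin p) m
      incr  : Linked F._<_ idx

  Sζ-sizes : {m : ℕ} → Vec (Fin p) m → Vec ℕ m
  Sζ-sizes idx = map (lookup sizes) idx

  proj : {m : ℕ} (idx : Vec (Fin p) m) → V → Tuple (Sζ-sizes idx)
  proj []        x = []
  proj (i ∷ idx) x = lookupT x i ∷ proj idx x

  S : (ζ : SubDetermination) → V → Tuple (Sζ-sizes (SubDetermination.idx ζ))
  S ζ = proj (SubDetermination.idx ζ)

  record WeakShortestPath (ζ : SubDetermination) (a b : V) : Set where
    field
      x      : V
      y      : V
      Sx     : S ζ x ≡ S ζ a
      Sy     : S ζ y ≡ S ζ b
      path   : Walk x y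
      isPath : IsPath path
      minimal : (x' y' : V) → S ζ x' ≡ S ζ a → S ζ y' ≡ S ζ b →
                (Q : Walk x' y') → IsPath Q → Len path ≤ Len Q

module Submission where

-- Composite vertices form a finite set and walks of a fixed length can be
-- enumerated, so "some path of length n joins the fibre of S_ζ(u_a) to the
-- fibre of S_ζ(u_b)" is decidable in n. Ps itself is such a path, so a least
-- such length exists below Len Ps, and any path realising it is a weak
-- shortest path.

open import Level using (Level)
open import Defs
open import Data.Nat using (ℕ; zero; suc; _≤_; _<_; z≤n; s≤s)
open import Data.Nat.Properties using (_≟_; ≤-refl; m≤n⇒m≤1+n; <-≤-trans; ≮⇒≥; anyUpTo?)
open import Data.Empty using (⊥-elim)
import Data.Fin.Properties as Fin
open import Data.Vec using (Vec; []; _∷_)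
open import Data.List using (List; []; _∷_; [_]; map; concat; concatMap; allFin; cartesianProductWith)
open import Data.List.Membership.Propositional using (_∈_; mapWith∈; lose)
open import Data.List.Membership.Propositional.Properties
  using (∈-map⁺; ∈-concat⁺′; ∈-concatMap⁺; ∈-allFin; ∈-cartesianProductWith⁺)
open import Data.List.Relation.Unary.Any using (here; any?; satisfied)
open import Data.List.Relation.Unary.Any.Properties using (mapWith∈⁺)
open import Data.Product using (Σ; ∃; _×_; _,_)
open import Relation.Binary.Definitions using (DecidableEquality)
open import Relation.Binary.PropositionalEquality using (_≡_; _≢_; refl)
open import Relation.Nullary using (yes; no; ¬_)
open import Relation.Nullary.Decidable using (_×-dec_; map′)
open import Relation.Unary using (Pred; Decidable)

_≟ᵀ_ : {p : ℕ} {ns : Vec ℕ p} → DecidableEquality (Tuple ns)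
[] ≟ᵀ [] = yes refl
(a ∷ s) ≟ᵀ (b ∷ t) with a Fin.≟ b | s ≟ᵀ t
... | yes refl | yes refl = yes refl
... | no a≢b   | _        = no λ { refl → a≢b refl }
... | yes _    | no s≢t   = no λ { refl → s≢t refl }

tuples : {p : ℕ} (ns : Vec ℕ p) → List (Tuple ns)
tuples []       = [ [] ]
tuples (n ∷ ns) = cartesianProductWith _∷_ (allFin n) (tuples ns)

∈-tuples : {p : ℕ} {ns : Vec ℕ p} (t : Tuple ns) → t ∈ tuples ns
∈-tuples []      = here refl
∈-tuples (a ∷ t) = ∈-cartesianProductWith⁺ _∷_ (∈-allFin a) (∈-tuples t)

module _ {ℓ : Level} {P : Pred ℕ ℓ} (P? : Decidable P) where

  least-witness-≤ : ∀ k → (∃ λ n → n ≤ k × P n) →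
                    ∃ λ n → n ≤ k × P n × (∀ {m} → m < n → ¬ P m)
  least-witness-≤ zero (n , z≤n , Pn) = n , z≤n , Pn , λ ()
  least-witness-≤ (suc k) (n , n≤1+k , Pn) with anyUpTo? P? (suc k)
  ... | yes (m , s≤s m≤k , Pm) with least-witness-≤ k (m , m≤k , Pm)
  ...   | l , l≤k , Pl , least = l , m≤n⇒m≤1+n l≤k , Pl , least
  least-witness-≤ (suc k) (n , n≤1+k , Pn) | no none =
    n , n≤1+k , Pn , λ m<n Pm → none (_ , <-≤-trans m<n n≤1+k , Pm)

module _ (H : MAG) where
  open MAG H

  walksOfLength : ℕ → (u : V) → List (∃ (Walk H u))
  prependEdge : ℕ → (u : V) → {e : V × V} → e ∈ E → List (∃ (Walk H u))
  walksOfLength zero    u = [ u , stop u ]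
  walksOfLength (suc n) u = concat (mapWith∈ E (prependEdge n u))
  prependEdge n u {a , b} ab∈E with a ≟ᵀ u
  ... | yes refl = map (λ (v , w) → v , step ab∈E w) (walksOfLength n b)
  ... | no _     = []

  ∈-walksOfLength : {u v : V} (w : Walk H u v) → (v , w) ∈ walksOfLength (Len H w) u
  ∈-walksOfLength (stop u) = here refl
  ∈-walksOfLength {u} (step ux∈E w) =
    ∈-concat⁺′ ∈-prependEdge (mapWith∈⁺ (prependEdge (Len H w) u) (_ , ux∈E , refl))
    where
    ∈-prependEdge : (_ , step ux∈E w) ∈ prependEdge (Len H w) u ux∈E
    ∈-prependEdge with u ≟ᵀ u
    ... | yes refl = ∈-map⁺ (λ (v , w) → v , step ux∈E w) (∈-walksOfLength w)
    ... | no u≢u   = ⊥-elim (u≢u refl)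

  Walks : Set
  Walks = Σ V λ x → ∃ (Walk H x)

  length : Walks → ℕ
  length (_ , _ , w) = Len H w

  allWalksOfLength : ℕ → List Walks
  allWalksOfLength n = concatMap (λ x → map (x ,_) (walksOfLength n x)) (tuples sizes)

  ∈-allWalksOfLength : (c : Walks) → c ∈ allWalksOfLength (length c)
  ∈-allWalksOfLength (x , _ , w) =
    ∈-concatMap⁺ _ (lose (∈-tuples x) (∈-map⁺ (x ,_) (∈-walksOfLength w)))

  anyWalkOfLength? : {ℓ : Level} {Q : Pred Walks ℓ} → Decidable Q →
                     Decidable (λ n → ∃ λ c → Q c × length c ≡ n)
  anyWalkOfLength? Q? n = map′ satisfied (λ { (c , Qc , refl) → lose (∈-allWalksOfLength c) (Qc , refl) })
    (any? (λ c → Q? c ×-dec (length c ≟ n)) (allWalksOfLength n))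

  module _ (ζ : SubDetermination H) (a b : V) where

    IsWeakPath : Walks → Set
    IsWeakPath (x , y , w) = S H ζ x ≡ S H ζ a × S H ζ y ≡ S H ζ b × IsPath H w

    open import Data.List.Relation.Unary.Unique.DecPropositional (_≟ᵀ_ {ns = sizes}) using (unique?)

    isWeakPath? : Decidable IsWeakPath
    isWeakPath? (x , y , w) =
      (S H ζ x ≟ᵀ S H ζ a) ×-dec (S H ζ y ≟ᵀ S H ζ b) ×-dec unique? (vertices H w)

    weakShortestPath-≤ : (c : Walks) → IsWeakPath c →
      Σ (WeakShortestPath H ζ a b) (λ Pζ → Len H (WeakShortestPath.path Pζ) ≤ length c)
    weakShortestPath-≤ c c-weak
      with least-witness-≤ (anyWalkOfLength? isWeakPath?) (length c) (_ , ≤-refl , c , c-weak , refl)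
    ... | _ , n≤ , ((x , y , w) , (Sx , Sy , w-path) , refl) , shorter =
      record { x = x ; y = y ; Sx = Sx ; Sy = Sy ; path = w ; isPath = w-path
             ; minimal = λ x′ y′ Sx′ Sy′ Q Q-path →
                 ≮⇒≥ λ Q<w → shorter Q<w ((x′ , y′ , Q) , (Sx′ , Sy′ , Q-path) , refl) }
      , n≤

theorem13 : (H : MAG) (ua ub : MAG.V H) → ua ≢ ub →
    (Ps : Walk H ua ub) → IsShortestPath H Ps →
    (ζ : SubDetermination H) →
    Σ (WeakShortestPath H ζ ua ub)
      (λ Pζ → Len H (WeakShortestPath.path Pζ) ≤ Len H Ps)
theorem13 H ua ub _ Ps (Ps-path , _) ζ =
  weakShortestPath-≤ H ζ ua ub (ua , ub , Ps) (refl , refl , Ps-path)
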